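{- A composite positive integer $n$ is a Carmichael number if and only if $\operatorname{rad}(\varphi(n))$ divides $n-1$ and $p-1$ divides $n-1$ for every prime divisor $p$ of $n$.
   Context: A Carmichael number is a composite positive integer $n$ such that $b^{n-1}\equiv 1\pmod n$ for every integer $b$ coprime to $n$. $\varphi$ is Euler's totient function and $\operatorname{rad}(m)$ is the product of the distinct primes dividing $m$. -}

module Defs where

open import Data.Nat using (ℕ; zero; suc; _∸_)
open import Data.Integer using (ℤ; +_; ∣_∣; _-_; _^_)
import Data.Integer.Divisibility as ℤDiv
open import Data.Nat.ListAction using (product)
open import Data.Nat.Divisibility using (_∣_; _∣?_)
open import Data.Nat.Coprimality using (Coprime; coprime?)
open import Data.Nat.Primality using (Prime; Composite; prime?)
open import Data.List using (List; filter; length; upTo; map)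
open import Data.Product using (_×_)
open import Relation.Nullary.Decidable using (_×-dec_)

oneTo : ℕ → List ℕ
oneTo n = map suc (upTo n)

φ : ℕ → ℕ
φ n = length (filter (λ k → coprime? k n) (oneTo n))

-- Radical: product of the distinct primes p dividing m (all such p satisfy p ≤ m when m ≥ 1).
-- (For m = 0 this gives 1; it is only ever applied to φ n ≥ 1.)
rad : ℕ → ℕ
rad m = product (filter (λ p → prime? p ×-dec (p ∣? m)) (oneTo m))

Carmichael : ℕ → Set
Carmichael n = Composite n × (∀ (b : ℤ) → Coprime ∣ b ∣ n → (+ n) ℤDiv.∣ (b ^ (n ∸ 1) - + 1))

module Submission where

-- The proof goes through Korselt's criterion: n ≥ 2 satisfies aⁿ⁻¹ ≡ 1 (mod n) for all a ⊥ n
-- iff n is squarefree and p − 1 ∣ n − 1 for all primes p ∣ n. Instead of primitive roots we use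
-- power sums: for 0 < r < p − 1 the prime p divides ∑_{b<p} bʳ, so bʳ ≡ 1 (mod p) cannot hold
-- for all 0 < b < p, i.e. the exponent of the units mod p is exactly p − 1. Residues mod p are
-- lifted to units mod n by an explicit formula rather than by the Chinese remainder theorem.
-- The radical condition then comes from φ: for squarefree n every prime dividing
-- φ(n) = ∏ (p − 1) divides some p − 1; conversely p² ∣ n gives p ∣ φ(n), so rad(φ(n)) ∣ n − 1
-- forces n to be squarefree.

open import Defs
open import Data.Nat using (ℕ; _∸_)
open import Data.Nat.Divisibility using (_∣_)
open import Data.Nat.Primality using (Prime; Composite)
open import Data.Product using (_×_)
open import Function.Bundles using (_⇔_)

open import Data.Nat
open import Data.Nat.Properties
open import Data.Nat.Divisibility
open import Data.Nat.DivMod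
open import Data.Nat.Coprimality using (Coprime; coprime?; coprime-divisor)
import Data.Nat.Coprimality as Coprime
open import Data.Nat.Primality
open import Data.Nat.Primality.Factorisation using (factorise; PrimeFactorisation; factorisationHasAllPrimeFactors)
open import Data.Nat.Combinatorics using (_C_; nCn≡1; nC1≡n; nCk≡nC[n∸k]; nCk+nC[k+1]≡[n+1]C[k+1]; k>n⇒nCk≡0)
open import Data.Nat.Induction using (<-rec)
open import Data.Nat.ListAction using (product)
open import Data.Nat.ListAction.Properties using (∈⇒∣product)
open import Data.Nat.Tactic.RingSolver using (solve-∀)
open import Data.Fin using (Fin; toℕ)
import Data.Fin as Fin
open import Data.List using (List; []; _∷_; filter; length; upTo; map; [_]; _++_)
open import Data.List.Properties using (upTo-∷ʳ; map-++; length-++; filter-++)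
open import Data.List.Membership.Propositional.Properties using (∈-map⁺; ∈-upTo⁺; ∈-filter⁺)
import Data.List.Relation.Unary.All as All
open import Data.List.Relation.Unary.All using (All; []; _∷_)
open import Data.List.Relation.Unary.All.Properties using (all-filter)
open import Data.List.Relation.Unary.AllPairs using ([]; _∷_)
open import Data.List.Relation.Unary.Unique.Propositional using (Unique)
import Data.List.Relation.Unary.Unique.Propositional.Properties as Unique
open import Data.Product using (_,_; ∃-syntax; proj₁; proj₂)
open import Data.Sum using (inj₁; inj₂)
open import Function using (id; case_of_)
open import Function.Bundles using (mk⇔; module Equivalence)
open import Relation.Nullary using (¬_; contradiction; Dec; yes; no)
open import Relation.Nullary.Decidable using (_×-dec_)
open import Relation.Unary using (Decidable)
open import Relation.Binary.PropositionalEquality hiding ([_])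
import Algebra.Properties.CommutativeSemiring.Binomial +-*-commutativeSemiring as Binomial
import Algebra.Properties.Semiring.Exp +-*-semiring as SemiringExp
import Algebra.Definitions.RawMonoid +-0-rawMonoid as Monoid+
open ≡-Reasoning

∑ : ℕ → (ℕ → ℕ) → ℕ
∑ zero    f = 0
∑ (suc n) f = ∑ n f + f n

∑-cong : ∀ n {f g : ℕ → ℕ} → (∀ i → i < n → f i ≡ g i) → ∑ n f ≡ ∑ n g
∑-cong zero    f≡g = refl
∑-cong (suc n) f≡g = cong₂ _+_ (∑-cong n (λ i i<n → f≡g i (m<n⇒m<1+n i<n))) (f≡g n ≤-refl)

∑-+ : ∀ n (f g : ℕ → ℕ) → ∑ n (λ i → f i + g i) ≡ ∑ n f + ∑ n g
∑-+ zero    f g = refl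
∑-+ (suc n) f g = begin
  ∑ n (λ i → f i + g i) + (f n + g n) ≡⟨ cong (_+ (f n + g n)) (∑-+ n f g) ⟩
  ∑ n f + ∑ n g + (f n + g n)         ≡⟨ interchange (∑ n f) (∑ n g) (f n) (g n) ⟩
  ∑ n f + f n + (∑ n g + g n)         ∎
  where
  interchange : ∀ a b c d → a + b + (c + d) ≡ a + c + (b + d)
  interchange = solve-∀

∑-const : ∀ n c → ∑ n (λ _ → c) ≡ n * c
∑-const zero    c = refl
∑-const (suc n) c = trans (cong (_+ c) (∑-const n c)) (+-comm (n * c) c)

∑-head : ∀ n (f : ℕ → ℕ) → ∑ (suc n) f ≡ f 0 + ∑ n (λ i → f (suc i))
∑-head zero    f = +-comm 0 (f 0)
∑-head (suc n) f = trans (cong (_+ f (suc n)) (∑-head n f)) (+-assoc (f 0) _ _)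

∑-split : ∀ a b (f : ℕ → ℕ) → ∑ (a + b) f ≡ ∑ a f + ∑ b (λ i → f (a + i))
∑-split a zero    f = trans (cong (λ k → ∑ k f) (+-identityʳ a)) (sym (+-identityʳ _))
∑-split a (suc b) f = begin
  ∑ (a + suc b) f                              ≡⟨ cong (λ k → ∑ k f) (+-suc a b) ⟩
  ∑ (a + b) f + f (a + b)                      ≡⟨ cong (_+ f (a + b)) (∑-split a b f) ⟩
  ∑ a f + ∑ b (λ i → f (a + i)) + f (a + b)    ≡⟨ +-assoc (∑ a f) _ _ ⟩
  ∑ a f + ∑ (suc b) (λ i → f (a + i))          ∎

∑-∣ : ∀ {d} n (f : ℕ → ℕ) → (∀ i → i < n → d ∣ f i) → d ∣ ∑ n f
∑-∣ zero    f d∣f = _ ∣0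
∑-∣ (suc n) f d∣f = ∣m∣n⇒∣m+n (∑-∣ n f (λ i i<n → d∣f i (m<n⇒m<1+n i<n))) (d∣f n ≤-refl)

-- The library's binomial theorem lives in an arbitrary commutative semiring, with its own
-- exponentiation, scalar multiplication and Fin-indexed sums; on ℕ these are the usual ones.
semiring-^ : ∀ x k → x SemiringExp.^ k ≡ x ^ k
semiring-^ x zero    = refl
semiring-^ x (suc k) = cong (x *_) (semiring-^ x k)

semiring-× : ∀ k x → k Monoid+.× x ≡ k * x
semiring-× zero    x = refl
semiring-× (suc k) x = cong (x +_) (semiring-× k x)

semiring-sum : ∀ n (g : Fin n → ℕ) (f : ℕ → ℕ) → (∀ i → g i ≡ f (toℕ i)) → Monoid+.sum g ≡ ∑ n f
semiring-sum zero    g f g≡f = refl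
semiring-sum (suc n) g f g≡f = begin
  g Fin.zero + Monoid+.sum (λ i → g (Fin.suc i))
    ≡⟨ cong₂ _+_ (g≡f Fin.zero) (semiring-sum n _ (λ i → f (suc i)) (λ i → g≡f (Fin.suc i))) ⟩
  f 0 + ∑ n (λ i → f (suc i))
    ≡⟨ sym (∑-head n f) ⟩
  ∑ (suc n) f ∎

binomial : ∀ x m → suc x ^ m ≡ ∑ (suc m) (λ j → (m C j) * x ^ j)
binomial x m = begin
  suc x ^ m                       ≡⟨ cong (_^ m) (+-comm 1 x) ⟩
  (x + 1) ^ m                     ≡⟨ sym (semiring-^ (x + 1) m) ⟩
  (x + 1) SemiringExp.^ m         ≡⟨ Binomial.theorem m x 1 ⟩
  Binomial.binomialExpansion x 1 m ≡⟨ semiring-sum (suc m) _ _ term ⟩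
  ∑ (suc m) (λ j → (m C j) * x ^ j) ∎
  where
  term : ∀ (j : Fin (suc m)) → (m C toℕ j) Monoid+.× (x SemiringExp.^ toℕ j * 1 SemiringExp.^ (m ∸ toℕ j))
                             ≡ (m C toℕ j) * x ^ toℕ j
  term j = begin
    (m C toℕ j) Monoid+.× (x SemiringExp.^ toℕ j * 1 SemiringExp.^ (m ∸ toℕ j))
      ≡⟨ semiring-× (m C toℕ j) _ ⟩
    (m C toℕ j) * (x SemiringExp.^ toℕ j * 1 SemiringExp.^ (m ∸ toℕ j))
      ≡⟨ cong₂ (λ u v → (m C toℕ j) * (u * v)) (semiring-^ x (toℕ j))
               (trans (semiring-^ 1 (m ∸ toℕ j)) (^-zeroˡ (m ∸ toℕ j))) ⟩
    (m C toℕ j) * (x ^ toℕ j * 1)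
      ≡⟨ cong ((m C toℕ j) *_) (*-identityʳ (x ^ toℕ j)) ⟩
    (m C toℕ j) * x ^ toℕ j ∎

C-absorb : ∀ n k → suc k * (suc n C suc k) ≡ suc n * (n C k)
C-absorb n       zero    = trans (+-identityʳ (suc n C 1)) (trans (nC1≡n (suc n)) (sym (*-identityʳ (suc n))))
C-absorb zero    (suc k) = begin
  suc (suc k) * (1 C suc (suc k)) ≡⟨ cong (suc (suc k) *_) (k>n⇒nCk≡0 {1} {suc (suc k)} (s<s z<s)) ⟩
  suc (suc k) * 0                 ≡⟨ *-zeroʳ (suc (suc k)) ⟩
  0                               ≡⟨ sym (k>n⇒nCk≡0 {0} {suc k} z<s) ⟩
  1 * (0 C suc k)                 ∎
C-absorb (suc n) (suc k) = begin
  suc (suc k) * (suc (suc n) C suc (suc k))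
    ≡⟨ cong (suc (suc k) *_) (sym (nCk+nC[k+1]≡[n+1]C[k+1] (suc n) (suc k))) ⟩
  suc (suc k) * (A + B)
    ≡⟨ regroup₁ k A B ⟩
  A + suc k * A + suc (suc k) * B
    ≡⟨ cong₂ (λ u v → A + u + v) (C-absorb n k) (C-absorb n (suc k)) ⟩
  A + suc n * (n C k) + suc n * (n C suc k)
    ≡⟨ regroup₂ n A (n C k) (n C suc k) ⟩
  A + suc n * ((n C k) + (n C suc k))
    ≡⟨ cong (λ u → A + suc n * u) (nCk+nC[k+1]≡[n+1]C[k+1] n k) ⟩
  suc (suc n) * A ∎
  where
  A B : ℕ
  A = suc n C suc k
  B = suc n C suc (suc k)
  regroup₁ : ∀ k A B → suc (suc k) * (A + B) ≡ A + suc k * A + suc (suc k) * B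
  regroup₁ = solve-∀
  regroup₂ : ∀ n A c d → A + suc n * c + suc n * d ≡ A + suc n * (c + d)
  regroup₂ = solve-∀

prime>1 : ∀ {p} → Prime p → 1 < p
prime>1 {p} pp = nonTrivial⇒n>1 p {{prime⇒nonTrivial pp}}

prime∣C : ∀ {p} → Prime p → ∀ k → 0 < k → k < p → p ∣ p C k
prime∣C {suc n} pp (suc j) _ j<n with euclidsLemma (suc j) (suc n C suc j) pp
                                        (subst (suc n ∣_) (sym (C-absorb n j)) (m∣m*n (n C j)))
... | inj₁ p∣k = contradiction (∣⇒≤ p∣k) (<⇒≱ j<n)
... | inj₂ p∣C = p∣C

module _ {d : ℕ} .{{_ : NonZero d}} where

  %-cong-+ : ∀ {a a′ b b′} → a % d ≡ a′ % d → b % d ≡ b′ % d → (a + b) % d ≡ (a′ + b′) % d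
  %-cong-+ {a} {a′} {b} {b′} a≡a′ b≡b′ = begin
    (a + b) % d           ≡⟨ %-distribˡ-+ a b d ⟩
    (a % d + b % d) % d   ≡⟨ cong₂ (λ u v → (u + v) % d) a≡a′ b≡b′ ⟩
    (a′ % d + b′ % d) % d ≡⟨ sym (%-distribˡ-+ a′ b′ d) ⟩
    (a′ + b′) % d         ∎

  %-cong-* : ∀ {a a′ b b′} → a % d ≡ a′ % d → b % d ≡ b′ % d → (a * b) % d ≡ (a′ * b′) % d
  %-cong-* {a} {a′} {b} {b′} a≡a′ b≡b′ = begin
    (a * b) % d             ≡⟨ %-distribˡ-* a b d ⟩
    (a % d * (b % d)) % d   ≡⟨ cong₂ (λ u v → (u * v) % d) a≡a′ b≡b′ ⟩
    (a′ % d * (b′ % d)) % d ≡⟨ sym (%-distribˡ-* a′ b′ d) ⟩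
    (a′ * b′) % d           ∎

  %-cong-^ : ∀ {a b} k → a % d ≡ b % d → (a ^ k) % d ≡ (b ^ k) % d
  %-cong-^ zero    a≡b = refl
  %-cong-^ (suc k) a≡b = %-cong-* a≡b (%-cong-^ k a≡b)

  %-cong-∑ : ∀ n (f g : ℕ → ℕ) → (∀ i → i < n → f i % d ≡ g i % d) → ∑ n f % d ≡ ∑ n g % d
  %-cong-∑ zero    f g f≡g = refl
  %-cong-∑ (suc n) f g f≡g = %-cong-+ (%-cong-∑ n f g (λ i i<n → f≡g i (m<n⇒m<1+n i<n))) (f≡g n ≤-refl)

  %≡⇒∣∸ : ∀ {a b} → a % d ≡ b % d → d ∣ a ∸ b
  %≡⇒∣∸ {a} {b} a≡b = divides (a / d ∸ b / d) (begin
    a ∸ b                                     ≡⟨ cong₂ _∸_ (m≡m%n+[m/n]*n a d) (m≡m%n+[m/n]*n b d) ⟩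
    (a % d + a / d * d) ∸ (b % d + b / d * d) ≡⟨ cong (λ r → (r + a / d * d) ∸ (b % d + b / d * d)) a≡b ⟩
    (b % d + a / d * d) ∸ (b % d + b / d * d) ≡⟨ [m+n]∸[m+o]≡n∸o (b % d) _ _ ⟩
    a / d * d ∸ b / d * d                     ≡⟨ sym (*-distribʳ-∸ d (a / d) (b / d)) ⟩
    (a / d ∸ b / d) * d                       ∎)

  ∣∸⇒%≡ : ∀ {a b} → b ≤ a → d ∣ a ∸ b → a % d ≡ b % d
  ∣∸⇒%≡ {a} {b} b≤a d∣a∸b = begin
    a % d           ≡⟨ cong (_% d) (sym (m+[n∸m]≡n b≤a)) ⟩
    (b + (a ∸ b)) % d ≡⟨ %-remove-+ʳ b d∣a∸b ⟩
    b % d           ∎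

-- Modulo a prime p (indeed any p ≥ 2) the residue of 1 is 1, so x ≡ 1 (mod p) can be
-- written x % p ≡ 1; these are its basic properties.
module _ {p : ℕ} .{{_ : NonZero p}} (pp : Prime p) where

  1%p : 1 % p ≡ 1
  1%p = m<n⇒m%n≡m (prime>1 pp)

  %-one-^ : ∀ {x} t → x % p ≡ 1 → (x ^ t) % p ≡ 1
  %-one-^ {x} t x≡1 = begin
    x ^ t % p ≡⟨ %-cong-^ t (trans x≡1 (sym 1%p)) ⟩
    1 ^ t % p ≡⟨ cong (_% p) (^-zeroˡ t) ⟩
    1 % p     ≡⟨ 1%p ⟩
    1         ∎

  %-one⇒∣ : ∀ {x} → x % p ≡ 1 → p ∣ x ∸ 1
  %-one⇒∣ x≡1 = %≡⇒∣∸ (trans x≡1 (sym 1%p))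

  ∣⇒%-one : ∀ {x} → 0 < x → p ∣ x ∸ 1 → x % p ≡ 1
  ∣⇒%-one x>0 p∣x∸1 = trans (∣∸⇒%≡ x>0 p∣x∸1) 1%p

-- Fermat's little theorem, aᵖ ≡ a (mod p), by induction on a: the binomial expansion of
-- (a + 1)ᵖ is aᵖ + 1 plus terms whose coefficients C(p, j), 0 < j < p, are multiples of p.
fermat : ∀ {p} .{{_ : NonZero p}} → Prime p → ∀ a → (a ^ p) % p ≡ a % p
fermat {suc n} pp zero    = refl
fermat {suc n} pp (suc a) = begin
  suc a ^ p % p                                 ≡⟨ cong (_% p) (binomial a p) ⟩
  ∑ (suc p) term % p                            ≡⟨ cong (λ s → (s + term p) % p) (∑-head n term) ⟩
  (1 + middle + (p C p) * a ^ p) % p            ≡⟨ cong (λ c → (1 + middle + c * a ^ p) % p) (nCn≡1 p) ⟩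
  (1 + middle + 1 * a ^ p) % p                  ≡⟨ cong (_% p) (regroup middle (a ^ p)) ⟩
  (middle + (1 + a ^ p)) % p                    ≡⟨ %-remove-+ˡ (1 + a ^ p) p∣middle ⟩
  (1 + a ^ p) % p                               ≡⟨ %-cong-+ {a = 1} {a′ = 1} refl (fermat pp a) ⟩
  suc a % p                                     ∎
  where
  p : ℕ
  p = suc n
  term : ℕ → ℕ
  term = λ j → (p C j) * a ^ j
  middle : ℕ
  middle = ∑ n (λ j → term (suc j))
  p∣middle : p ∣ middle
  p∣middle = ∑-∣ n _ (λ j j<n → ∣m⇒∣m*n (a ^ suc j) (prime∣C pp (suc j) z<s (s<s j<n)))
  regroup : ∀ m x → 1 + m + 1 * x ≡ m + (1 + x)
  regroup = solve-∀

fermat-little : ∀ {p} .{{_ : NonZero p}} → Prime p → ∀ a → ¬ p ∣ a → (a ^ (p ∸ 1)) % p ≡ 1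
fermat-little {suc n} pp zero    p∤a = contradiction (suc n ∣0) p∤a
fermat-little {suc n} pp (suc a) p∤a with euclidsLemma (suc a) (suc a ^ n ∸ 1) pp p∣a[aⁿ-1]
  where
  p∣a[aⁿ-1] : suc n ∣ suc a * (suc a ^ n ∸ 1)
  p∣a[aⁿ-1] = subst (suc n ∣_) (begin
      suc a ^ suc n ∸ suc a           ≡⟨ cong (suc a ^ suc n ∸_) (sym (*-identityʳ (suc a))) ⟩
      suc a * suc a ^ n ∸ suc a * 1   ≡⟨ sym (*-distribˡ-∸ (suc a) (suc a ^ n) 1) ⟩
      suc a * (suc a ^ n ∸ 1)         ∎)
    (%≡⇒∣∸ {a = suc a ^ suc n} {b = suc a} (fermat pp (suc a)))
... | inj₁ p∣a   = contradiction p∣a p∤a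
... | inj₂ p∣x∸1 = ∣⇒%-one pp (m^n>0 (suc a) n) p∣x∸1

powerSum : ℕ → ℕ → ℕ
powerSum k N = ∑ N (λ b → b ^ k)

-- Nᵏ⁺¹ = ∑_{j ≤ k} C(k + 1, j)·S_j(N): sum the binomial expansions of (b + 1)ᵏ⁺¹ − bᵏ⁺¹ over b < N.
powerSum-identity : ∀ k N → N ^ suc k ≡ ∑ (suc k) (λ j → (suc k C j) * powerSum j N)
powerSum-identity k zero    = sym (trans (∑-cong (suc k) (λ j _ → *-zeroʳ (suc k C j)))
                                         (trans (∑-const (suc k) 0) (*-zeroʳ (suc k))))
powerSum-identity k (suc N) = begin
  suc N ^ suc k
    ≡⟨ binomial N (suc k) ⟩
  expansion + (suc k C suc k) * N ^ suc k
    ≡⟨ cong (λ c → expansion + c * N ^ suc k) (nCn≡1 (suc k)) ⟩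
  expansion + 1 * N ^ suc k
    ≡⟨ trans (cong (expansion +_) (*-identityˡ (N ^ suc k))) (+-comm expansion (N ^ suc k)) ⟩
  N ^ suc k + expansion
    ≡⟨ cong (_+ expansion) (powerSum-identity k N) ⟩
  ∑ (suc k) (λ j → (suc k C j) * powerSum j N) + expansion
    ≡⟨ sym (∑-+ (suc k) (λ j → (suc k C j) * powerSum j N) (λ j → (suc k C j) * N ^ j)) ⟩
  ∑ (suc k) (λ j → (suc k C j) * powerSum j N + (suc k C j) * N ^ j)
    ≡⟨ ∑-cong (suc k) (λ j _ → sym (*-distribˡ-+ (suc k C j) (powerSum j N) (N ^ j))) ⟩
  ∑ (suc k) (λ j → (suc k C j) * powerSum j (suc N)) ∎
  where
  expansion : ℕ
  expansion = ∑ (suc k) (λ j → (suc k C j) * N ^ j)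

-- For 0 < k < p − 1 the prime p divides S_k(p): taking N = p above, p divides the left side
-- and (by strong induction on k) every term except (k + 1)·S_k(p), while p ∤ k + 1.
prime∣powerSum : ∀ {p} → Prime p → ∀ k → 0 < k → suc k < p → p ∣ powerSum k p
prime∣powerSum {p} pp = <-rec (λ k → 0 < k → suc k < p → p ∣ powerSum k p) step
  where
  step : ∀ k → (∀ {j} → j < k → 0 < j → suc j < p → p ∣ powerSum j p) → 0 < k → suc k < p → p ∣ powerSum k p
  step k ih _ k+1<p with euclidsLemma (suc k) (powerSum k p) pp p∣[k+1]Sₖ
    where
    term : ℕ → ℕ
    term j = (suc k C j) * powerSum j p
    p∣term : ∀ j → j < k → p ∣ term j
    p∣term zero    _   = ∣n⇒∣m*n (suc k C 0) (subst (p ∣_) (sym (trans (∑-const p 1) (*-identityʳ p))) ∣-refl)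
    p∣term (suc j) j<k = ∣n⇒∣m*n (suc k C suc j) (ih j<k z<s (<-trans (s<s j<k) k+1<p))
    [k+1]Cₖ≡k+1 : suc k C k ≡ suc k
    [k+1]Cₖ≡k+1 = trans (nCk≡nC[n∸k] (n≤1+n k)) (trans (cong (suc k C_) (m+n∸n≡m 1 k)) (nC1≡n (suc k)))
    p∣[k+1]Sₖ : p ∣ suc k * powerSum k p
    p∣[k+1]Sₖ = subst (λ c → p ∣ c * powerSum k p) [k+1]Cₖ≡k+1
      (∣m+n∣m⇒∣n (subst (p ∣_) (powerSum-identity k p) (m∣m*n (p ^ k))) (∑-∣ k term p∣term))
  ... | inj₁ p∣k+1 = contradiction (∣⇒≤ p∣k+1) (<⇒≱ k+1<p)
  ... | inj₂ p∣Sₖ  = p∣Sₖ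

-- Hence no exponent r with 0 < r < p − 1 has bʳ ≡ 1 (mod p) for all 0 < b < p: summing over
-- b < p would give p − 1 ≡ S_r(p) ≡ 0 (mod p).
no-small-universal-exponent : ∀ {p} .{{_ : NonZero p}} → Prime p → ∀ r → 0 < r → suc r < p →
  ¬ (∀ b → 0 < b → b < p → (b ^ r) % p ≡ 1)
no-small-universal-exponent {suc q} pp r@(suc _) r>0 r+1<p bʳ≡1 = <⇒≢ (prime>1 pp) (cong suc (sym q≡0))
  where
  p : ℕ
  p = suc q
  isPositive : ℕ → ℕ
  isPositive zero    = 0
  isPositive (suc _) = 1
  bʳ≡isPositive : ∀ b → b < p → (b ^ r) % p ≡ isPositive b % p
  bʳ≡isPositive zero    _   = refl
  bʳ≡isPositive (suc b) b<p = trans (bʳ≡1 (suc b) z<s b<p) (sym (1%p pp))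
  Sᵣ≡q : powerSum r p % p ≡ q
  Sᵣ≡q = begin
    powerSum r p % p     ≡⟨ %-cong-∑ p _ isPositive bʳ≡isPositive ⟩
    ∑ p isPositive % p   ≡⟨ cong (_% p) (trans (∑-head q isPositive) (trans (∑-const q 1) (*-identityʳ q))) ⟩
    q % p                ≡⟨ m<n⇒m%n≡m ≤-refl ⟩
    q                    ∎
  q≡0 : q ≡ 0
  q≡0 = trans (sym Sᵣ≡q) (n∣m⇒m%n≡0 (powerSum r p) p (prime∣powerSum pp r r>0 r+1<p))

-- Writing e = r + (p − 1)t with r < p − 1, Fermat gives bʳ ≡ bᵉ ≡ 1 for all such b,
-- which forces r = 0.
units-exponent : ∀ {p} .{{_ : NonZero p}} → Prime p → ∀ e →
  (∀ b → 0 < b → b < p → (b ^ e) % p ≡ 1) → p ∸ 1 ∣ e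
units-exponent {1} pp = contradiction pp ¬prime[1]
units-exponent {suc q@(suc _)} pp e bᵉ≡1 with e % q in r≡e%q
... | zero  = m%n≡0⇒n∣m e q r≡e%q
... | suc r = contradiction bʳ⁺¹≡1 (no-small-universal-exponent pp (suc r) z<s r+1<q+1)
  where
  p : ℕ
  p = suc q
  e≡ : e ≡ suc r + q * (e / q)
  e≡ = trans (m≡m%n+[m/n]*n e q) (cong₂ _+_ r≡e%q (*-comm (e / q) q))
  r+1<q+1 : suc (suc r) < p
  r+1<q+1 = s<s (subst (_< q) r≡e%q (m%n<n e q))
  bʳ⁺¹≡1 : ∀ b → 0 < b → b < p → (b ^ suc r) % p ≡ 1
  bʳ⁺¹≡1 b b>0 b<p = begin
    b ^ suc r % p                   ≡⟨ cong (_% p) (sym (*-identityʳ (b ^ suc r))) ⟩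
    b ^ suc r * 1 % p               ≡⟨ %-cong-* {a = b ^ suc r} {a′ = b ^ suc r} {b = 1} {b′ = b ^ (q * (e / q))}
                                                refl (trans (1%p pp) (sym bᑫᵗ≡1)) ⟩
    b ^ suc r * b ^ (q * (e / q)) % p ≡⟨ cong (_% p) (sym (^-distribˡ-+-* b (suc r) (q * (e / q)))) ⟩
    b ^ (suc r + q * (e / q)) % p   ≡⟨ cong (λ x → b ^ x % p) (sym e≡) ⟩
    b ^ e % p                       ≡⟨ bᵉ≡1 b b>0 b<p ⟩
    1                               ∎
    where
    bᑫᵗ≡1 : (b ^ (q * (e / q))) % p ≡ 1
    bᑫᵗ≡1 = trans (cong (_% p) (sym (^-*-assoc b q (e / q))))
                  (%-one-^ pp (e / q) (fermat-little pp b (λ p∣b → <⇒≱ b<p (∣⇒≤ {{>-nonZero b>0}} p∣b))))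

prime-divisor : ∀ n → 2 ≤ n → ∃[ p ] (Prime p × p ∣ n)
prime-divisor n 2≤n = first-factor factors isFactorisation factorsPrime
  where
  open PrimeFactorisation (factorise n {{>-nonZero (<-trans z<s 2≤n)}})
  first-factor : ∀ ps → n ≡ product ps → All Prime ps → ∃[ p ] (Prime p × p ∣ n)
  first-factor []       n≡1    _        = contradiction (sym n≡1) (<⇒≢ 2≤n)
  first-factor (p ∷ ps) n≡p*ps (pp ∷ _) = p , pp , divides (product ps) (trans n≡p*ps (*-comm p (product ps)))

prime∣prime⇒≡ : ∀ {p q} → Prime p → Prime q → p ∣ q → p ≡ q
prime∣prime⇒≡ pp pq p∣q with prime⇒irreducible pq p∣q
... | inj₁ p≡1 = contradiction p≡1 (>⇒≢ (prime>1 pp))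
... | inj₂ p≡q = p≡q

prime∤suc : ∀ {r x} → Prime r → r ∣ x → ¬ r ∣ suc x
prime∤suc {r} {x} pr r∣x r∣x+1 =
  >⇒≢ (prime>1 pr) (∣1⇒≡1 (∣m+n∣m⇒∣n (subst (r ∣_) (+-comm 1 x) r∣x+1) r∣x))

-- Two numbers are coprime as soon as they have no prime factor in common: a common divisor d
-- is not 0 (2 would be a common prime factor) and not ≥ 2 (a prime factor of d would be).
coprime-by-primes : ∀ {a b} → (∀ r → Prime r → r ∣ a → ¬ r ∣ b) → Coprime a b
coprime-by-primes no-common {0} (0∣a , 0∣b) =
  contradiction (subst (2 ∣_) (sym (0∣⇒≡0 0∣b)) (2 ∣0))
                (no-common 2 prime[2] (subst (2 ∣_) (sym (0∣⇒≡0 0∣a)) (2 ∣0)))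
coprime-by-primes no-common {1} _ = refl
coprime-by-primes no-common {d@(suc (suc _))} (d∣a , d∣b) with prime-divisor d (s≤s (s≤s z≤n))
... | r , pr , r∣d = contradiction (∣-trans r∣d d∣b) (no-common r pr (∣-trans r∣d d∣a))

coprime⇒no-common-prime : ∀ {a b r} → Coprime a b → Prime r → r ∣ a → ¬ r ∣ b
coprime⇒no-common-prime a⊥b pr r∣a r∣b = >⇒≢ (prime>1 pr) (a⊥b (r∣a , r∣b))

prime-coprime : ∀ {p m} → Prime p → ¬ p ∣ m → Coprime p m
prime-coprime pp p∤m = coprime-by-primes λ r pr r∣p r∣m → p∤m (subst (_∣ _) (prime∣prime⇒≡ pr pp r∣p) r∣m)

coprime-*-∣ : ∀ {a b x} → Coprime a b → a ∣ x → b ∣ x → a * b ∣ x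
coprime-*-∣ {a} {b} a⊥b (divides k refl) b∣ka with coprime-divisor (Coprime.sym a⊥b) (subst (b ∣_) (*-comm k a) b∣ka)
... | divides j refl = divides j (trans (*-assoc j b a) (cong (j *_) (*-comm b a)))

SquareFree : ℕ → Set
SquareFree n = ∀ p → Prime p → ¬ p * p ∣ n

squarefree-induction : (P : ℕ → Set) → P 1 → (∀ {p m} → Prime p → ¬ p ∣ m → P m → P (p * m)) →
  ∀ n → SquareFree n → P n
squarefree-induction P P[1] P[p*m] = <-rec (λ n → SquareFree n → P n) build
  where
  build : ∀ n → (∀ {m} → m < n → SquareFree m → P m) → SquareFree n → P n
  build 0 _ sf = contradiction (4 ∣0) (sf 2 prime[2])
  build 1 _ _  = P[1]
  build n@(suc (suc _)) ih sf with prime-divisor n (s≤s (s≤s z≤n))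
  ... | p , pp , divides m@(suc _) n≡m*p =
    subst P (trans (*-comm p m) (sym n≡m*p)) (P[p*m] pp p∤m (ih m<n m-squarefree))
    where
    m∣n : m ∣ n
    m∣n = divides p (trans n≡m*p (*-comm m p))
    p∤m : ¬ p ∣ m
    p∤m p∣m = sf p pp (subst (p * p ∣_) (sym n≡m*p) (*-monoˡ-∣ p p∣m))
    m-squarefree : SquareFree m
    m-squarefree q pq q²∣m = sf q pq (∣-trans q²∣m m∣n)
    m<n : m < n
    m<n = subst (m <_) (sym n≡m*p) (m<m*n m p (prime>1 pp))

squarefree-∣ : ∀ {x} n → SquareFree n → (∀ p → Prime p → p ∣ n → p ∣ x) → n ∣ x
squarefree-∣ {x} = squarefree-induction (λ n → (∀ p → Prime p → p ∣ n → p ∣ x) → n ∣ x) (λ _ → 1∣ x) step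
  where
  step : ∀ {p m} → Prime p → ¬ p ∣ m → ((∀ q → Prime q → q ∣ m → q ∣ x) → m ∣ x) →
         (∀ q → Prime q → q ∣ p * m → q ∣ x) → p * m ∣ x
  step {p} {m} pp p∤m m∣x primes∣x = coprime-*-∣ (prime-coprime pp p∤m) (primes∣x p pp (m∣m*n m))
    (m∣x (λ q pq q∣m → primes∣x q pq (∣n⇒∣m*n p q∣m)))

indicator : ∀ {A : Set} → Dec A → ℕ
indicator (yes _) = 1
indicator (no _)  = 0

indicator-cong : ∀ {A B : Set} (a : Dec A) (b : Dec B) → (A → B) → (B → A) → indicator a ≡ indicator b
indicator-cong (yes _) (yes _) _   _   = refl
indicator-cong (yes a) (no ¬b) A→B _   = contradiction (A→B a) ¬b
indicator-cong (no ¬a) (yes b) _   B→A = contradiction (B→A b) ¬a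
indicator-cong (no _)  (no _)  _   _   = refl

indicator-yes : ∀ {A : Set} (a : Dec A) → A → indicator a ≡ 1
indicator-yes a x = indicator-cong a (yes x) id id

indicator-no : ∀ {A : Set} (a : Dec A) → ¬ A → indicator a ≡ 0
indicator-no a ¬x = indicator-cong a (no ¬x) id id

length-filter-singleton : ∀ {P : ℕ → Set} (P? : Decidable P) x → length (filter P? [ x ]) ≡ indicator (P? x)
length-filter-singleton P? x with P? x
... | yes _ = refl
... | no _  = refl

length-filter-oneTo : ∀ {P : ℕ → Set} (P? : Decidable P) m →
  length (filter P? (oneTo m)) ≡ ∑ m (λ i → indicator (P? (suc i)))
length-filter-oneTo P? zero    = refl
length-filter-oneTo P? (suc m) = begin
  length (filter P? (map suc (upTo (suc m))))
    ≡⟨ cong (λ xs → length (filter P? (map suc xs))) (sym (upTo-∷ʳ m)) ⟩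
  length (filter P? (map suc (upTo m ++ [ m ])))
    ≡⟨ cong (λ xs → length (filter P? xs)) (map-++ suc (upTo m) [ m ]) ⟩
  length (filter P? (oneTo m ++ [ suc m ]))
    ≡⟨ cong length (filter-++ P? (oneTo m) [ suc m ]) ⟩
  length (filter P? (oneTo m) ++ filter P? [ suc m ])
    ≡⟨ length-++ (filter P? (oneTo m)) ⟩
  length (filter P? (oneTo m)) + length (filter P? [ suc m ])
    ≡⟨ cong₂ _+_ (length-filter-oneTo P? m) (length-filter-singleton P? (suc m)) ⟩
  ∑ (suc m) (λ i → indicator (P? (suc i))) ∎

coprimeTo : ℕ → ℕ → ℕ
coprimeTo n k = indicator (coprime? k n)

φ-∑ : ∀ n → φ n ≡ ∑ n (λ i → coprimeTo n (suc i))
φ-∑ n = length-filter-oneTo (λ k → coprime? k n) n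

∑-periodic : ∀ m (f : ℕ → ℕ) → (∀ k → f (k + m) ≡ f k) → ∀ j → ∑ (j * m) f ≡ j * ∑ m f
∑-periodic m f periodic zero    = refl
∑-periodic m f periodic (suc j) = begin
  ∑ (m + j * m) f                         ≡⟨ ∑-split m (j * m) f ⟩
  ∑ m f + ∑ (j * m) (λ i → f (m + i))     ≡⟨ cong (∑ m f +_) (∑-cong (j * m) (λ i _ →
                                               trans (cong f (+-comm m i)) (periodic i))) ⟩
  ∑ m f + ∑ (j * m) f                     ≡⟨ cong (∑ m f +_) (∑-periodic m f periodic j) ⟩
  ∑ m f + j * ∑ m f                       ∎

∑-multiples : ∀ p .{{_ : NonZero p}} (g : ℕ → ℕ) → (∀ k → ¬ p ∣ k → g k ≡ 0) →
  ∀ j → ∑ (p * j) (λ i → g (suc i)) ≡ ∑ j (λ i → g (p * suc i))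
∑-multiples (suc q) g g≡0 zero    = cong (λ k → ∑ k (λ i → g (suc i))) (*-zeroʳ q)
∑-multiples (suc q) g g≡0 (suc j) = begin
  ∑ (p * suc j) g′
    ≡⟨ cong (λ k → ∑ k g′) (trans (*-suc p j) (+-comm p (p * j))) ⟩
  ∑ (p * j + p) g′
    ≡⟨ ∑-split (p * j) p g′ ⟩
  ∑ (p * j) g′ + (∑ q (λ i → g′ (p * j + i)) + g′ (p * j + q))
    ≡⟨ cong₂ (λ u v → ∑ (p * j) g′ + (u + v))
             (trans (∑-cong q (λ i i<q → g≡0 _ (p∤ i i<q))) (trans (∑-const q 0) (*-zeroʳ q)))
             (cong g (last-index q j)) ⟩
  ∑ (p * j) g′ + (0 + g (p * suc j))
    ≡⟨ cong (_+ g (p * suc j)) (∑-multiples p g g≡0 j) ⟩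
  ∑ (suc j) (λ i → g (p * suc i)) ∎
  where
  p : ℕ
  p = suc q
  g′ : ℕ → ℕ
  g′ = λ i → g (suc i)
  p∤ : ∀ i → i < q → ¬ p ∣ suc (p * j + i)
  p∤ i i<q p∣ = <⇒≱ (s≤s i<q) (∣⇒≤ (∣m+n∣m⇒∣n (subst (p ∣_) (sym (+-suc (p * j) i)) p∣) (m∣m*n j)))
  last-index : ∀ q j → suc (suc q * j + q) ≡ suc q * suc j
  last-index = solve-∀

coprimeTo-periodic : ∀ {n m} → (∀ r → Prime r → r ∣ n → r ∣ m) → ∀ k → coprimeTo n (k + m) ≡ coprimeTo n k
coprimeTo-periodic {n} {m} primes∣m k = indicator-cong (coprime? (k + m) n) (coprime? k n)
  (λ k+m⊥n → coprime-by-primes λ r pr r∣k r∣n →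
     coprime⇒no-common-prime k+m⊥n pr (∣m∣n⇒∣m+n r∣k (primes∣m r pr r∣n)) r∣n)
  (λ k⊥n → coprime-by-primes λ r pr r∣k+m r∣n →
     coprime⇒no-common-prime k⊥n pr (∣m+n∣m⇒∣n (subst (r ∣_) (+-comm k m) r∣k+m) (primes∣m r pr r∣n)) r∣n)

coprimeTo-∑-periodic : ∀ {n m} → (∀ r → Prime r → r ∣ n → r ∣ m) → ∀ j →
  ∑ (j * m) (λ i → coprimeTo n (suc i)) ≡ j * ∑ m (λ i → coprimeTo n (suc i))
coprimeTo-∑-periodic {n} {m} primes∣m =
  ∑-periodic m (λ i → coprimeTo n (suc i)) (λ k → coprimeTo-periodic primes∣m (suc k))

-- If p² ∣ n then p ∣ φ(n): writing n = p·m, every prime factor of n divides m, so the units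
-- among 1, …, n are p copies of those among 1, …, m.
square∣⇒∣φ : ∀ {p n} → Prime p → p * p ∣ n → p ∣ φ n
square∣⇒∣φ {p} {n} pp (divides k n≡k*p²) = subst (p ∣_) (sym φn≡p*_) (m∣m*n _)
  where
  m : ℕ
  m = k * p
  n≡p*m : n ≡ p * m
  n≡p*m = trans n≡k*p² (regroup k p)
    where
    regroup : ∀ k p → k * (p * p) ≡ p * (k * p)
    regroup = solve-∀
  primes∣m : ∀ r → Prime r → r ∣ n → r ∣ m
  primes∣m r pr r∣n with euclidsLemma p m pr (subst (r ∣_) n≡p*m r∣n)
  ... | inj₁ r∣p = subst (_∣ m) (sym (prime∣prime⇒≡ pr pp r∣p)) (n∣m*n k)
  ... | inj₂ r∣m = r∣m
  φn≡p*_ : φ n ≡ p * ∑ m (λ i → coprimeTo n (suc i))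
  φn≡p*_ = trans (φ-∑ n) (trans (cong (λ x → ∑ x (λ i → coprimeTo n (suc i))) n≡p*m) (coprimeTo-∑-periodic primes∣m p))

-- Among 1, …, p·m there
-- are p·φ(m) numbers coprime to m; those coprime to p·m are the ones not divisible by p, and
-- the multiples p·k coprime to m correspond to the φ(m) numbers k ≤ m coprime to m.
module _ {p m : ℕ} (pp : Prime p) (p∤m : ¬ p ∣ m) where

  multipleCoprimeTo : ℕ → ℕ
  multipleCoprimeTo k = indicator (p ∣? k) * coprimeTo m k

  coprimeTo-split : ∀ k → coprimeTo m k ≡ coprimeTo (p * m) k + multipleCoprimeTo k
  coprimeTo-split k = split (p ∣? k)
    where
    split : (p∣?k : Dec (p ∣ k)) → coprimeTo m k ≡ coprimeTo (p * m) k + indicator p∣?k * coprimeTo m k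
    split (yes p∣k) = sym (cong₂ _+_
      (indicator-no (coprime? k (p * m)) (λ k⊥pm → coprime⇒no-common-prime k⊥pm pp p∣k (m∣m*n m)))
      (*-identityˡ (coprimeTo m k)))
    split (no p∤k) = trans
      (indicator-cong (coprime? k m) (coprime? k (p * m))
        (λ k⊥m → coprime-by-primes λ r pr r∣k r∣pm → case euclidsLemma p m pr r∣pm of λ where
           (inj₁ r∣p) → p∤k (subst (_∣ k) (prime∣prime⇒≡ pr pp r∣p) r∣k)
           (inj₂ r∣m) → coprime⇒no-common-prime k⊥m pr r∣k r∣m)
        (λ k⊥pm → coprime-by-primes λ r pr r∣k r∣m → coprime⇒no-common-prime k⊥pm pr r∣k (∣n⇒∣m*n p r∣m)))
      (sym (+-identityʳ _))

  multipleCoprimeTo-p* : ∀ k → multipleCoprimeTo (p * k) ≡ coprimeTo m k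
  multipleCoprimeTo-p* k = begin
    indicator (p ∣? (p * k)) * coprimeTo m (p * k) ≡⟨ cong (_* coprimeTo m (p * k)) (indicator-yes (p ∣? (p * k)) (m∣m*n k)) ⟩
    1 * coprimeTo m (p * k)                       ≡⟨ *-identityˡ _ ⟩
    coprimeTo m (p * k)                           ≡⟨ indicator-cong (coprime? (p * k) m) (coprime? k m) pk⊥m⇒k⊥m k⊥m⇒pk⊥m ⟩
    coprimeTo m k                                 ∎
    where
    pk⊥m⇒k⊥m : Coprime (p * k) m → Coprime k m
    pk⊥m⇒k⊥m pk⊥m = coprime-by-primes λ r pr r∣k r∣m → coprime⇒no-common-prime pk⊥m pr (∣n⇒∣m*n p r∣k) r∣m
    k⊥m⇒pk⊥m : Coprime k m → Coprime (p * k) m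
    k⊥m⇒pk⊥m k⊥m = coprime-by-primes λ r pr r∣pk r∣m → case euclidsLemma p k pr r∣pk of λ where
      (inj₁ r∣p) → p∤m (subst (_∣ m) (prime∣prime⇒≡ pr pp r∣p) r∣m)
      (inj₂ r∣k) → coprime⇒no-common-prime k⊥m pr r∣k r∣m

  multipleCoprimeTo-∤ : ∀ k → ¬ p ∣ k → multipleCoprimeTo k ≡ 0
  multipleCoprimeTo-∤ k p∤k = cong (_* coprimeTo m k) (indicator-no (p ∣? k) p∤k)

  φ-p*m+φ-m : φ (p * m) + φ m ≡ p * φ m
  φ-p*m+φ-m = sym (begin
    p * φ m
      ≡⟨ cong (p *_) (φ-∑ m) ⟩
    p * ∑ m (λ i → coprimeTo m (suc i))
      ≡⟨ sym (coprimeTo-∑-periodic (λ r _ r∣m → r∣m) p) ⟩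
    ∑ (p * m) (λ i → coprimeTo m (suc i))
      ≡⟨ ∑-cong (p * m) (λ i _ → coprimeTo-split (suc i)) ⟩
    ∑ (p * m) (λ i → coprimeTo (p * m) (suc i) + multipleCoprimeTo (suc i))
      ≡⟨ ∑-+ (p * m) _ _ ⟩
    ∑ (p * m) (λ i → coprimeTo (p * m) (suc i)) + ∑ (p * m) (λ i → multipleCoprimeTo (suc i))
      ≡⟨ cong₂ _+_ (sym (φ-∑ (p * m))) (∑-multiples p {{prime⇒nonZero pp}} multipleCoprimeTo multipleCoprimeTo-∤ m) ⟩
    φ (p * m) + ∑ m (λ i → multipleCoprimeTo (p * suc i))
      ≡⟨ cong (φ (p * m) +_) (trans (∑-cong m (λ i _ → multipleCoprimeTo-p* (suc i))) (sym (φ-∑ m))) ⟩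
    φ (p * m) + φ m ∎)

  φ-p* : φ (p * m) ≡ (p ∸ 1) * φ m
  φ-p* = begin
    φ (p * m)                 ≡⟨ sym (m+n∸n≡m (φ (p * m)) (φ m)) ⟩
    φ (p * m) + φ m ∸ φ m     ≡⟨ cong (_∸ φ m) φ-p*m+φ-m ⟩
    p * φ m ∸ φ m             ≡⟨ cong (λ x → p * φ m ∸ x) (sym (*-identityˡ (φ m))) ⟩
    p * φ m ∸ 1 * φ m         ≡⟨ sym (*-distribʳ-∸ (φ m) p 1) ⟩
    (p ∸ 1) * φ m             ∎

-- φ(n) ≥ 1 for n ≥ 1, because 1 is coprime to n.
φ-pos : ∀ n → 0 < n → 0 < φ n
φ-pos (suc n) _ = subst (0 <_) (sym φ≡1+_) z<s
  where
  rest : ℕ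
  rest = ∑ n (λ i → coprimeTo (suc n) (suc (suc i)))
  φ≡1+_ : φ (suc n) ≡ suc rest
  φ≡1+_ = trans (φ-∑ (suc n)) (trans (∑-head n (λ i → coprimeTo (suc n) (suc i)))
            (cong (_+ rest) (indicator-yes (coprime? 1 (suc n)) (λ (d∣1 , _) → ∣1⇒≡1 d∣1))))

-- For squarefree n, every prime q dividing φ(n) divides p − 1 for some prime p ∣ n,
-- since φ(p₁⋯pₖ) = (p₁ − 1)⋯(pₖ − 1).
prime∣φ-squarefree : ∀ n → SquareFree n → ∀ q → Prime q → q ∣ φ n → ∃[ p ] (Prime p × p ∣ n × q ∣ p ∸ 1)
prime∣φ-squarefree = squarefree-induction P P[1] P[p*m]
  where
  P : ℕ → Set
  P n = ∀ q → Prime q → q ∣ φ n → ∃[ p ] (Prime p × p ∣ n × q ∣ p ∸ 1)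
  P[1] : P 1
  P[1] q pq q∣1 = contradiction (∣1⇒≡1 q∣1) (>⇒≢ (prime>1 pq))
  P[p*m] : ∀ {p m} → Prime p → ¬ p ∣ m → P m → P (p * m)
  P[p*m] {p} {m} pp p∤m P[m] q pq q∣φ with euclidsLemma (p ∸ 1) (φ m) pq (subst (q ∣_) (φ-p* pp p∤m) q∣φ)
  ... | inj₁ q∣p-1 = p , pp , m∣m*n m , q∣p-1
  ... | inj₂ q∣φm with P[m] q pq q∣φm
  ...   | p′ , pp′ , p′∣m , q∣p′-1 = p′ , pp′ , ∣n⇒∣m*n p p′∣m , q∣p′-1

distinct-primes-product-∣ : ∀ x (ps : List ℕ) → Unique ps → All (λ p → Prime p × p ∣ x) ps → product ps ∣ x
distinct-primes-product-∣ x []       _            _                 = 1∣ x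
distinct-primes-product-∣ x (p ∷ ps) (p∉ps ∷ uniq) ((pp , p∣x) ∷ ps∣x) =
  coprime-*-∣ (prime-coprime pp p∤ps) p∣x (distinct-primes-product-∣ x ps uniq ps∣x)
  where
  p∤ps : ¬ p ∣ product ps
  p∤ps p∣ps = All.lookup p∉ps (factorisationHasAllPrimeFactors pp p∣ps (All.map proj₁ ps∣x)) refl

rad-least : ∀ m x → (∀ q → Prime q → q ∣ m → q ∣ x) → rad m ∣ x
rad-least m x primes∣x = distinct-primes-product-∣ x _ distinct
  (All.map (λ {p} (pp , p∣m) → pp , primes∣x p pp p∣m) (all-filter primeFactor? (oneTo m)))
  where
  primeFactor? : Decidable (λ p → Prime p × p ∣ m)
  primeFactor? = λ p → prime? p ×-dec (p ∣? m)
  distinct : Unique (filter primeFactor? (oneTo m))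
  distinct = Unique.filter⁺ primeFactor? (Unique.map⁺ suc-injective (Unique.upTo⁺ m))

prime∣rad : ∀ {m q} → 0 < m → Prime q → q ∣ m → q ∣ rad m
prime∣rad {m} {suc q} m>0 pq q∣m =
  ∈⇒∣product (∈-filter⁺ (λ p → prime? p ×-dec (p ∣? m))
                        (∈-map⁺ suc (∈-upTo⁺ (∣⇒≤ {{>-nonZero m>0}} q∣m))) (pq , q∣m))

-- The defining property of Carmichael numbers, read in ℕ: aⁿ⁻¹ ≡ 1 (mod n) for all a ⊥ n.
FermatCondition : ℕ → Set
FermatCondition n = ∀ a → Coprime a n → n ∣ a ^ (n ∸ 1) ∸ 1

KorseltCondition : ℕ → Set
KorseltCondition n = ∀ p → Prime p → p ∣ n → p ∸ 1 ∣ n ∸ 1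

binomial-mod-square : ∀ m k → ∃[ t ] (suc m ^ k ≡ 1 + k * m + m * m * t)
binomial-mod-square m zero    = 0 , expand m
  where
  expand : ∀ m → 1 ≡ 1 + 0 * m + m * m * 0
  expand = solve-∀
binomial-mod-square m (suc k) with binomial-mod-square m k
... | t , eq = t + k + m * t , trans (cong (suc m *_) eq) (expand m k t)
  where
  expand : ∀ m k t → suc m * (1 + k * m + m * m * t) ≡ 1 + suc k * m + m * m * (t + k + m * t)
  expand = solve-∀

-- The Fermat condition forces n to be squarefree: if n = p·m with p ∣ m, then 1 + m ⊥ n and
-- (1 + m)ⁿ⁻¹ ≡ 1 + (n − 1)·m (mod n, as n ∣ m²), so n ∣ (n − 1)·m, whence n ∣ m < n.
fermat⇒squarefree : ∀ n → 2 ≤ n → FermatCondition n → SquareFree n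
fermat⇒squarefree n 2≤n fermat-n p pp (divides k n≡k*p²) = <⇒≱ m<n (∣⇒≤ {{>-nonZero m>0}} n∣m)
  where
  m : ℕ
  m = k * p
  e : ℕ
  e = n ∸ 1
  n≡1+e : n ≡ 1 + e
  n≡1+e = sym (m+[n∸m]≡n (<-trans z<s 2≤n))
  n≡p*m : n ≡ p * m
  n≡p*m = trans n≡k*p² (regroup k p)
    where
    regroup : ∀ k p → k * (p * p) ≡ p * (k * p)
    regroup = solve-∀
  m>0 : 0 < m
  m>0 = n≢0⇒n>0 λ m≡0 → <⇒≢ (<-trans z<s 2≤n) (sym (trans n≡p*m (trans (cong (p *_) m≡0) (*-zeroʳ p))))
  m<n : m < n
  m<n = subst (m <_) (trans (*-comm m p) (sym n≡p*m)) (m<m*n m p {{>-nonZero m>0}} (prime>1 pp))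
  primes∣m : ∀ r → Prime r → r ∣ n → r ∣ m
  primes∣m r pr r∣n with euclidsLemma p m pr (subst (r ∣_) n≡p*m r∣n)
  ... | inj₁ r∣p = subst (_∣ m) (sym (prime∣prime⇒≡ pr pp r∣p)) (n∣m*n k)
  ... | inj₂ r∣m = r∣m
  1+m⊥n : Coprime (suc m) n
  1+m⊥n = coprime-by-primes λ r pr r∣1+m r∣n → prime∤suc pr (primes∣m r pr r∣n) r∣1+m
  t : ℕ
  t = proj₁ (binomial-mod-square m e)
  n∣m*m*t : n ∣ m * m * t
  n∣m*m*t = ∣m⇒∣m*n t (divides k (trans (regroup k p) (cong (k *_) (sym n≡k*p²))))
    where
    regroup : ∀ k p → k * p * (k * p) ≡ k * (k * (p * p))
    regroup = solve-∀
  n∣e*m : n ∣ e * m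
  n∣e*m = ∣m+n∣m⇒∣n (subst (n ∣_) (trans (cong (_∸ 1) (proj₂ (binomial-mod-square m e))) (+-comm (e * m) (m * m * t)))
                                   (fermat-n (suc m) 1+m⊥n))
                    n∣m*m*t
  n∣m : n ∣ m
  n∣m = ∣m+n∣m⇒∣n (subst (n ∣_) (trans (cong (_* m) n≡1+e) (+-comm m (e * m))) (m∣m*n m)) n∣e*m

coprime⇒pos : ∀ {a n} → 2 ≤ n → Coprime a n → 0 < a
coprime⇒pos {zero}  {n} 2≤n 0⊥n = contradiction (sym (0⊥n (n ∣0 , ∣-refl))) (<⇒≢ 2≤n)
coprime⇒pos {suc a}     _   _   = z<s

-- Residues mod p lift to units mod m·p when p ∤ m: c = 1 + mᵖ⁻¹·(b + p − 1) is ≡ b (mod p)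
-- by Fermat and ≡ 1 modulo each prime factor of m, so for 0 < b < p it is coprime to m·p.
-- (This replaces the Chinese remainder theorem in the usual proof.)
lift-residue : ∀ {p m} .{{_ : NonZero p}} → Prime p → ¬ p ∣ m → ∀ b → 0 < b → b < p →
  ∃[ c ] (Coprime c (m * p) × c % p ≡ b % p)
lift-residue {0}                 pp = contradiction pp ¬prime[0]
lift-residue {1}                 pp = contradiction pp ¬prime[1]
lift-residue {p@(suc q@(suc q′))} {m} pp p∤m b b>0 b<p = c , c⊥mp , c≡b
  where
  c : ℕ
  c = 1 + m ^ q * (b + q)
  c≡b : c % p ≡ b % p
  c≡b = begin
    c % p                  ≡⟨ %-cong-+ {a = 1} {a′ = 1} {b = m ^ q * (b + q)} {b′ = 1 * (b + q)} refl
                                (%-cong-* {a = m ^ q} {a′ = 1} {b = b + q} {b′ = b + q} mᵠ≡1 refl) ⟩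
    (1 + 1 * (b + q)) % p  ≡⟨ cong (_% p) (regroup b q) ⟩
    (b + p) % p            ≡⟨ [m+n]%n≡m%n b p ⟩
    b % p                  ∎
    where
    mᵠ≡1 : m ^ q % p ≡ 1 % p
    mᵠ≡1 = trans (fermat-little pp m p∤m) (sym (1%p pp))
    regroup : ∀ b q → 1 + 1 * (b + q) ≡ b + suc q
    regroup = solve-∀
  p∤b : ¬ p ∣ b
  p∤b p∣b = <⇒≱ b<p (∣⇒≤ {{>-nonZero b>0}} p∣b)
  c⊥mp : Coprime c (m * p)
  c⊥mp = coprime-by-primes λ r pr r∣c r∣mp → case euclidsLemma m p pr r∣mp of λ where
    (inj₁ r∣m) → prime∤suc pr (∣m⇒∣m*n (b + q) (∣m⇒∣m*n (m ^ q′) r∣m)) r∣c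
    (inj₂ r∣p) → p∤b (m%n≡0⇒n∣m b p (trans (sym c≡b)
                    (n∣m⇒m%n≡0 c p (subst (_∣ c) (prime∣prime⇒≡ pr pp r∣p) r∣c))))

-- The Fermat condition together with squarefreeness gives Korselt's condition: for p ∣ n,
-- write n = m·p with p ∤ m; lifting each 0 < b < p to a unit c mod n shows bⁿ⁻¹ ≡ cⁿ⁻¹ ≡ 1
-- (mod p), so p − 1 ∣ n − 1 by the exponent of the units mod p.
fermat⇒korselt : ∀ n → 2 ≤ n → FermatCondition n → SquareFree n → KorseltCondition n
fermat⇒korselt n 2≤n fermat-n sf p pp (divides m n≡m*p) = units-exponent pp (n ∸ 1) bⁿ⁻¹≡1
  where
  instance
    p≢0 : NonZero p
    p≢0 = prime⇒nonZero pp
  e : ℕ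
  e = n ∸ 1
  p∤m : ¬ p ∣ m
  p∤m p∣m = sf p pp (subst (p * p ∣_) (sym n≡m*p) (*-monoˡ-∣ p p∣m))
  bⁿ⁻¹≡1 : ∀ b → 0 < b → b < p → (b ^ e) % p ≡ 1
  bⁿ⁻¹≡1 b b>0 b<p with lift-residue pp p∤m b b>0 b<p
  ... | c , c⊥mp , c≡b = begin
    b ^ e % p ≡⟨ %-cong-^ e (sym c≡b) ⟩
    c ^ e % p ≡⟨ ∣⇒%-one pp (m^n>0 c {{>-nonZero (coprime⇒pos 2≤n c⊥n)}} e)
                   (∣-trans (divides m n≡m*p) (fermat-n c c⊥n)) ⟩
    1         ∎
    where
    c⊥n : Coprime c n
    c⊥n = subst (Coprime c) (sym n≡m*p) c⊥mp

-- Conversely (Korselt), squarefree n with Korselt's condition satisfies the Fermat condition: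
-- for a ⊥ n and each prime p ∣ n, Fermat gives aⁿ⁻¹ = (aᵖ⁻¹)ᵗ ≡ 1 (mod p).
korselt⇒fermat : ∀ n → SquareFree n → KorseltCondition n → FermatCondition n
korselt⇒fermat n sf korselt a a⊥n = squarefree-∣ n sf p∣aⁿ⁻¹-1
  where
  p∣aⁿ⁻¹-1 : ∀ p → Prime p → p ∣ n → p ∣ a ^ (n ∸ 1) ∸ 1
  p∣aⁿ⁻¹-1 p pp p∣n with korselt p pp p∣n
  ... | divides t n-1≡t*[p-1] = %-one⇒∣ pp (begin
    a ^ (n ∸ 1) % p       ≡⟨ cong (λ x → a ^ x % p) (trans n-1≡t*[p-1] (*-comm t (p ∸ 1))) ⟩
    a ^ ((p ∸ 1) * t) % p ≡⟨ cong (_% p) (sym (^-*-assoc a (p ∸ 1) t)) ⟩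
    (a ^ (p ∸ 1)) ^ t % p ≡⟨ %-one-^ pp t (fermat-little pp a (λ p∣a → coprime⇒no-common-prime a⊥n pp p∣a p∣n)) ⟩
    1                     ∎)
    where
    instance
      p≢0 : NonZero p
    p≢0 = prime⇒nonZero pp

-- The integer form of the Fermat condition, used in the definition of Carmichael numbers.
-- Integer syntax is kept local to this block (its prefix +_ clashes with ℕ sections).
module _ where
  open import Data.Integer as ℤ using (ℤ; +_; -[1+_]; ∣_∣)
  import Data.Integer.Properties as ℤ
  import Data.Integer.Divisibility as ℤ
  import Data.Integer.Divisibility.Signed as ℤ±
  import Data.Integer.Tactic.RingSolver as ℤ-Ring

  _∣ᶠ_ : ℕ → ℤ → Set
  n ∣ᶠ b = (+ n) ℤ.∣ (b ℤ.^ (n ∸ 1) ℤ.- + 1)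

  +-^ : ∀ a k → (+ a) ℤ.^ k ≡ + (a ^ k)
  +-^ a zero    = refl
  +-^ a (suc k) = trans (cong (+ a ℤ.*_) (+-^ a k)) (sym (ℤ.pos-* a (a ^ k)))

  ∣ᶠ-+ : ∀ n a → 0 < a → n ∣ᶠ (+ a) ≡ (n ∣ a ^ (n ∸ 1) ∸ 1)
  ∣ᶠ-+ n a a>0 = cong (n ∣_) (begin
    ∣ (+ a) ℤ.^ k ℤ.- + 1 ∣   ≡⟨ cong (λ x → ∣ x ℤ.- + 1 ∣) (+-^ a k) ⟩
    ∣ + (a ^ k) ℤ.- + 1 ∣     ≡⟨ cong ∣_∣ (trans (ℤ.[+m]-[+n]≡m⊖n (a ^ k) 1) (ℤ.⊖-≥ (m^n>0 a {{>-nonZero a>0}} k))) ⟩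
    a ^ k ∸ 1                 ∎)
    where k = n ∸ 1

  ∣-pow-difference : ∀ k x y e → k ℤ±.∣ (x ℤ.- y) → k ℤ±.∣ (x ℤ.^ e ℤ.- y ℤ.^ e)
  ∣-pow-difference k x y zero    _      = ℤ±.divides (+ 0) refl
  ∣-pow-difference k x y (suc e) k∣x-y = subst (k ℤ±.∣_) (sym (telescope x y (x ℤ.^ e) (y ℤ.^ e)))
    (ℤ±.∣m∣n⇒∣m+n (ℤ±.∣n⇒∣m*n x (∣-pow-difference k x y e k∣x-y)) (ℤ±.∣n⇒∣m*n (y ℤ.^ e) k∣x-y))
    where
    telescope : ∀ x y X Y → x ℤ.* X ℤ.- y ℤ.* Y ≡ x ℤ.* (X ℤ.- Y) ℤ.+ Y ℤ.* (x ℤ.- y)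
    telescope = ℤ-Ring.solve-∀

  -- The integer and natural Fermat conditions agree for n ≥ 2. A negative b = −(a + 1) is
  -- ≡ c = (a + 1)(n − 1) (mod n), and c is coprime to n whenever b is.
  fermat-ℤ⇔ℕ : ∀ n → 2 ≤ n → (∀ b → Coprime ∣ b ∣ n → n ∣ᶠ b) ⇔ FermatCondition n
  fermat-ℤ⇔ℕ n 2≤n = mk⇔ to from
    where
    to : (∀ b → Coprime ∣ b ∣ n → n ∣ᶠ b) → FermatCondition n
    to fermat-ℤ a a⊥n = subst (λ P → P) (∣ᶠ-+ n a (coprime⇒pos 2≤n a⊥n)) (fermat-ℤ (+ a) a⊥n)
    e : ℕ
    e = n ∸ 1
    n≡1+e : n ≡ suc e
    n≡1+e = sym (m+[n∸m]≡n (<-trans z<s 2≤n))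
    from : FermatCondition n → ∀ b → Coprime ∣ b ∣ n → n ∣ᶠ b
    from fermat-ℕ (+ a)     a⊥n = subst (λ P → P) (sym (∣ᶠ-+ n a (coprime⇒pos 2≤n a⊥n))) (fermat-ℕ a a⊥n)
    from fermat-ℕ -[1+ a ] a⊥n = ℤ±.∣⇒∣ᵤ (subst ((+ n) ℤ±.∣_) (regroup (b ℤ.^ e) ((+ c) ℤ.^ e))
        (ℤ±.∣m∣n⇒∣m+n (∣-pow-difference (+ n) b (+ c) e n∣b-c) n∣cᵉ-1))
      where
      b : ℤ
      b = -[1+ a ]
      c : ℕ
      c = suc a Data.Nat.* e
      c⊥n : Coprime c n
      c⊥n = coprime-by-primes λ r pr r∣c r∣n → case euclidsLemma (suc a) e pr r∣c of λ where
        (inj₁ r∣a+1) → coprime⇒no-common-prime a⊥n pr r∣a+1 r∣n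
        (inj₂ r∣e)   → prime∤suc pr r∣e (subst (r ∣_) n≡1+e r∣n)
      n∣cᵉ-1 : (+ n) ℤ±.∣ ((+ c) ℤ.^ e ℤ.- + 1)
      n∣cᵉ-1 = ℤ±.∣ᵤ⇒∣ (subst (λ P → P) (sym (∣ᶠ-+ n c (coprime⇒pos 2≤n c⊥n))) (fermat-ℕ c c⊥n))
      b-c≡-[a+1]n : b ℤ.- + c ≡ ℤ.- ((+ suc a) ℤ.* (+ n))
      b-c≡-[a+1]n = begin
        ℤ.- (+ suc a) ℤ.- + c                       ≡⟨ cong (λ x → ℤ.- (+ suc a) ℤ.- x) (ℤ.pos-* (suc a) e) ⟩
        ℤ.- (+ suc a) ℤ.- (+ suc a) ℤ.* (+ e)       ≡⟨ factor (+ suc a) (+ e) ⟩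
        ℤ.- ((+ suc a) ℤ.* (+ 1 ℤ.+ + e))           ≡⟨ cong (λ x → ℤ.- ((+ suc a) ℤ.* x)) (cong +_ (sym n≡1+e)) ⟩
        ℤ.- ((+ suc a) ℤ.* (+ n))                   ∎
        where
        factor : ∀ A E → ℤ.- A ℤ.- A ℤ.* E ≡ ℤ.- (A ℤ.* (+ 1 ℤ.+ E))
        factor = ℤ-Ring.solve-∀
      n∣b-c : (+ n) ℤ±.∣ (b ℤ.- + c)
      n∣b-c = subst ((+ n) ℤ±.∣_) (sym b-c≡-[a+1]n) (ℤ±.∣m⇒∣-m (ℤ±.∣n⇒∣m*n (+ suc a) ℤ±.∣-refl))
      regroup : ∀ X Y → (X ℤ.- Y) ℤ.+ (Y ℤ.- + 1) ≡ X ℤ.- + 1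
      regroup = ℤ-Ring.solve-∀

mainTheorem6 : (n : ℕ) → Composite n →
    Carmichael n ⇔ (rad (φ n) ∣ n ∸ 1 × (∀ (p : ℕ) → Prime p → p ∣ n → p ∸ 1 ∣ n ∸ 1))
mainTheorem6 n n-composite = mk⇔ carmichael⇒ ⇒carmichael
  where
  2≤n : 2 ≤ n
  2≤n = nonTrivial⇒n>1 n {{composite⇒nonTrivial n-composite}}
  open Equivalence (fermat-ℤ⇔ℕ n 2≤n) renaming (to to fermat-ℤ⇒ℕ; from to fermat-ℕ⇒ℤ)
  carmichael⇒ : Carmichael n → rad (φ n) ∣ n ∸ 1 × KorseltCondition n
  carmichael⇒ (_ , fermat-ℤ) = rad-least (φ n) (n ∸ 1) q∣n-1 , korselt
    where
    fermat-n : FermatCondition n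
    fermat-n = fermat-ℤ⇒ℕ fermat-ℤ
    squarefree : SquareFree n
    squarefree = fermat⇒squarefree n 2≤n fermat-n
    korselt : KorseltCondition n
    korselt = fermat⇒korselt n 2≤n fermat-n squarefree
    -- every prime q ∣ φ(n) divides some p − 1 with p ∣ n, hence divides n − 1
    q∣n-1 : ∀ q → Prime q → q ∣ φ n → q ∣ n ∸ 1
    q∣n-1 q pq q∣φn with prime∣φ-squarefree n squarefree q pq q∣φn
    ... | p , pp , p∣n , q∣p-1 = ∣-trans q∣p-1 (korselt p pp p∣n)
  ⇒carmichael : rad (φ n) ∣ n ∸ 1 × KorseltCondition n → Carmichael n
  ⇒carmichael (rad∣n-1 , korselt) = n-composite , fermat-ℕ⇒ℤ (korselt⇒fermat n squarefree korselt)
    where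
    -- p² ∣ n would give p ∣ φ(n), hence p ∣ rad φ(n) ∣ n − 1, while also p ∣ n
    squarefree : SquareFree n
    squarefree p pp p²∣n = prime∤suc pp p∣n-1 (subst (p ∣_) n≡1+[n-1] (m*n∣⇒m∣ p p p²∣n))
      where
      p∣n-1 : p ∣ n ∸ 1
      p∣n-1 = ∣-trans (prime∣rad (φ-pos n (<-trans z<s 2≤n)) pp (square∣⇒∣φ pp p²∣n)) rad∣n-1
      n≡1+[n-1] : n ≡ suc (n ∸ 1)
      n≡1+[n-1] = sym (m+[n∸m]≡n (<-trans z<s 2≤n))
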